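{- Let $n\ge2$, $\mathbf{b}=b_1\cdots b_{n-2}\in\{0,1\}^{n-2}$ and suppose $b_i=0$. Then $G_{\mathbf{b}}$ contains a non-spine edge $(i+1,i+2)$, and there is exactly one other edge $(p,q)$ of $G_{\mathbf{b}}$ with $p<i+1<i+2<q$ (i.e. in which it is nested).
   Context: For $\mathbf{b}\in\{0,1\}^{n-2}$ with $\{i:b_i=1\}=\{j_1<\dots<j_r\}$, $G_{\mathbf{b}}$ is the DAG on vertex set $[n+1]$ whose edge multiset consists of: the spine edges $(i,i+1)$ for $i\in[n]$; additional copies of $(1,2)$ and $(n,n+1)$; an additional copy of $(l+1,l+2)$ for each $l\in[n-2]$ with $b_l=0$; and the edges $(1,j_1+2),(j_1+1,j_2+2),\dots,(j_{r-1}+1,j_r+2),(j_r+1,n+1)$ (just $(1,n+1)$ if $r=0$). -}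

module Defs where

open import Data.Nat using (ℕ; zero; suc; _+_; _∸_; _<ᵇ_)
open import Data.Bool using (Bool; true; false; _∧_)
open import Data.List using (List; []; _∷_; _++_; map; upTo)
open import Data.Product using (_×_; _,_)
open import Data.Vec using (Vec; toList)

-- A directed edge (p , q) on vertex set [n+1] = {1,…,n+1} (1-indexed naturals).
Edge : Set
Edge = ℕ × ℕ

indexed : ℕ → List Bool → List (ℕ × Bool)
indexed k []       = []
indexed k (x ∷ xs) = (k , x) ∷ indexed (suc k) xs

spineEdges : ℕ → List Edge
spineEdges n = map (λ i → (suc i , suc (suc i))) (upTo n)

zeroEdges : List (ℕ × Bool) → List Edge
zeroEdges []               = []
zeroEdges ((l , false) ∷ xs) = (l + 1 , l + 2) ∷ zeroEdges xs
zeroEdges ((l , true)  ∷ xs) = zeroEdges xs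

onePositions : List (ℕ × Bool) → List ℕ
onePositions []                = []
onePositions ((l , true)  ∷ xs) = l ∷ onePositions xs
onePositions ((l , false) ∷ xs) = onePositions xs

jumpChain : ℕ → ℕ → List ℕ → List Edge
jumpChain n s []       = (s , n + 1) ∷ []
jumpChain n s (j ∷ js) = (s , j + 2) ∷ jumpChain n (j + 1) js

-- the non-spine edges of G_b (as a multiset / list)
nonSpineEdges : (n : ℕ) → Vec Bool (n ∸ 2) → List Edge
nonSpineEdges n b =
  ((1 , 2) ∷ (n , n + 1) ∷ [])
  ++ zeroEdges (indexed 1 (toList b))
  ++ jumpChain n 1 (onePositions (indexed 1 (toList b)))

edgesG : (n : ℕ) → Vec Bool (n ∸ 2) → List Edge
edgesG n b = spineEdges n ++ nonSpineEdges n b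

countᵇ : {A : Set} → (A → Bool) → List A → ℕ
countᵇ P []       = 0
countᵇ P (x ∷ xs) with P x
... | true  = suc (countᵇ P xs)
... | false = countᵇ P xs

nestsOver : ℕ → ℕ → Edge → Bool
nestsOver a c (p , q) = (p <ᵇ a) ∧ (c <ᵇ q)

-- The edge (i+1, i+2) is the extra copy contributed by b_i = 0. Apart from the jump chain
-- 1 → j₁+2, j₁+1 → j₂+2, …, jᵣ+1 → n+1, every edge of G_b has length one, and no edge of
-- length one nests over another. A chain edge nests over (i+1, i+2) exactly when it jumps
-- from a cut point below i to one above i; since j₁ < … < jᵣ and i is not among them,
-- exactly one edge of the chain does.
module Submission where

open import Defs
open import Data.Nat using (ℕ; suc; _+_; _∸_; _≤_; _<_; z≤n; s≤s)
open import Data.Nat.Properties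
  using (+-comm; +-suc; +-identityʳ; <⇒<ᵇ; <ᵇ⇒<; <-asym; <-irrefl; <-trans; <-cmp;
         ≤-refl; ≤-trans; n≤1+n; m<n⇒m<1+n; ≤-pred; ≤⇒≯; m≤m+n; <⇒≤)
open import Data.Bool using (Bool; true; false; T)
open import Data.Bool.Properties using (T-∧)
open import Data.Fin using (Fin; toℕ)
open import Data.Fin.Properties using (toℕ<n)
open import Data.Vec using (Vec; lookup)
open import Data.Product using (_×_; _,_)
open import Data.Empty using (⊥-elim)
open import Data.List using (List; []; _∷_; _++_)
open import Data.List.Properties using (++-assoc)
open import Data.List.Membership.Propositional using (_∈_; _∉_)
open import Data.List.Relation.Unary.All as All using (All; []; _∷_)
open import Data.List.Relation.Unary.All.Properties using (map⁺; ++⁺)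
open import Data.List.Relation.Unary.AllPairs using (AllPairs; []; _∷_)
open import Data.List.Relation.Unary.Any using (here; there)
open import Data.List.Relation.Unary.Any.Properties using (++⁺ˡ)
open import Function.Base using (_∘_)
open import Function.Bundles using (_⇔_; mk⇔; Equivalence)
open import Relation.Binary.Definitions using (tri<; tri≈; tri>)
open import Relation.Nullary using (¬_)
open import Relation.Binary.PropositionalEquality
  using (_≡_; refl; sym; trans; cong; cong₂; subst; module ≡-Reasoning)

import Data.Vec as Vec
import Data.Fin as Fin

private
  variable
    A : Set
    P : A → Bool
    xs : List A

countᵇ-++ : (P : A → Bool) (xs ys : List A) →
            countᵇ P (xs ++ ys) ≡ countᵇ P xs + countᵇ P ys
countᵇ-++ P []       ys = refl
countᵇ-++ P (x ∷ xs) ys with P x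
... | true  = cong suc (countᵇ-++ P xs ys)
... | false = countᵇ-++ P xs ys

countᵇ-∷⁺ : (P : A → Bool) (x : A) → T (P x) → countᵇ P (x ∷ xs) ≡ suc (countᵇ P xs)
countᵇ-∷⁺ P x px with P x
... | true = refl

countᵇ-∷⁻ : (P : A → Bool) (x : A) → ¬ T (P x) → countᵇ P (x ∷ xs) ≡ countᵇ P xs
countᵇ-∷⁻ P x ¬px with P x
... | true  = ⊥-elim (¬px _)
... | false = refl

countᵇ-none : All (λ x → ¬ T (P x)) xs → countᵇ P xs ≡ 0
countᵇ-none []           = refl
countᵇ-none {P = P} {x ∷ _} (¬px ∷ ¬pxs) = trans (countᵇ-∷⁻ P x ¬px) (countᵇ-none ¬pxs)

nestsOver⇔ : ∀ {a c p q} → T (nestsOver a c (p , q)) ⇔ (p < a × c < q)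
nestsOver⇔ {a} {c} {p} {q} = mk⇔
  (λ t → let (p<a , c<q) = Equivalence.to T-∧ t in <ᵇ⇒< p a p<a , <ᵇ⇒< c q c<q)
  (λ { (p<a , c<q) → Equivalence.from T-∧ (<⇒<ᵇ p<a , <⇒<ᵇ c<q) })

UnitEdge : Edge → Set
UnitEdge (p , q) = q ≡ suc p

unitEdge-¬nestsOver : ∀ {a e} → UnitEdge e → ¬ T (nestsOver a (suc a) e)
unitEdge-¬nestsOver {a} {p , .(suc p)} refl t
  with p<a , s≤s a<p ← Equivalence.to (nestsOver⇔ {a} {suc a} {p} {suc p}) t = <-asym p<a a<p

countᵇ-nestsOver-unitEdges : ∀ {a es} → All UnitEdge es → countᵇ (nestsOver a (suc a)) es ≡ 0
countᵇ-nestsOver-unitEdges units = countᵇ-none (All.map unitEdge-¬nestsOver units)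

spineEdges-unit : ∀ n → All UnitEdge (spineEdges n)
spineEdges-unit n = map⁺ (All.universal (λ _ → refl) _)

zeroEdges-unit : ∀ k xs → All UnitEdge (zeroEdges (indexed k xs))
zeroEdges-unit k []           = []
zeroEdges-unit k (true ∷ xs)  = zeroEdges-unit (suc k) xs
zeroEdges-unit k (false ∷ xs) = +-suc k 1 ∷ zeroEdges-unit (suc k) xs

-- With a = i, this tests whether an edge nests over (i+1, i+2).
nestsCut : ℕ → Edge → Bool
nestsCut a = nestsOver (suc a) (2 + a)

¬nestsCut-lateStart : ∀ {a} p q → a < p → ¬ T (nestsCut a (p , q))
¬nestsCut-lateStart {a} p q a<p t
  with s≤s p≤a , _ ← Equivalence.to (nestsOver⇔ {suc a} {2 + a} {p} {q}) t = ≤⇒≯ p≤a a<p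

¬nestsCut-earlyEnd : ∀ {a} p j → j ≤ a → ¬ T (nestsCut a (p , j + 2))
¬nestsCut-earlyEnd {a} p j j≤a t
  with _ , 2+a<j+2 ← Equivalence.to (nestsOver⇔ {suc a} {2 + a} {p} {j + 2}) t
  rewrite +-comm j 2 = ≤⇒≯ j≤a (≤-pred (≤-pred 2+a<j+2))

jumpChain-above : ∀ n {a s js} → a < s → All (a <_) js → countᵇ (nestsCut a) (jumpChain n s js) ≡ 0
jumpChain-above n {a} {s} a<s [] = countᵇ-∷⁻ (nestsCut a) (s , n + 1) (¬nestsCut-lateStart s (n + 1) a<s)
jumpChain-above n {a} {s} {j ∷ js} a<s (a<j ∷ a<js) = begin
  countᵇ (nestsCut a) (jumpChain n s (j ∷ js))
    ≡⟨ countᵇ-∷⁻ (nestsCut a) (s , j + 2) (¬nestsCut-lateStart s (j + 2) a<s) ⟩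
  countᵇ (nestsCut a) (jumpChain n (j + 1) js)
    ≡⟨ jumpChain-above n (subst (a <_) (+-comm 1 j) (m<n⇒m<1+n a<j)) a<js ⟩
  0 ∎
  where open ≡-Reasoning

jumpChain-straddle : ∀ n {a s js} → s ≤ a → 2 + a ≤ n → AllPairs _<_ js → a ∉ js →
                     countᵇ (nestsCut a) (jumpChain n s js) ≡ 1
jumpChain-straddle n {a} {s} s≤a 2+a≤n [] _ =
  countᵇ-∷⁺ (nestsCut a) (s , n + 1)
    (Equivalence.from nestsOver⇔ (s≤s s≤a , subst (2 + a <_) (+-comm 1 n) (s≤s 2+a≤n)))
jumpChain-straddle n {a} {s} {j ∷ js} s≤a 2+a≤n (j<js ∷ js↑) a∉j∷js with <-cmp j a
... | tri< j<a _ _ = begin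
  countᵇ (nestsCut a) (jumpChain n s (j ∷ js))
    ≡⟨ countᵇ-∷⁻ (nestsCut a) (s , j + 2) (¬nestsCut-earlyEnd s j (<⇒≤ j<a)) ⟩
  countᵇ (nestsCut a) (jumpChain n (j + 1) js)
    ≡⟨ jumpChain-straddle n (subst (_≤ a) (+-comm 1 j) j<a) 2+a≤n js↑ (a∉j∷js ∘ there) ⟩
  1 ∎
  where open ≡-Reasoning
... | tri≈ _ j≡a _ = ⊥-elim (a∉j∷js (here (sym j≡a)))
... | tri> _ _ a<j = begin
  countᵇ (nestsCut a) (jumpChain n s (j ∷ js))
    ≡⟨ countᵇ-∷⁺ (nestsCut a) (s , j + 2)
         (Equivalence.from nestsOver⇔ (s≤s s≤a , subst (2 + a <_) (+-comm 2 j) (s≤s (s≤s a<j)))) ⟩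
  suc (countᵇ (nestsCut a) (jumpChain n (j + 1) js))
    ≡⟨ cong suc (jumpChain-above n (subst (a <_) (+-comm 1 j) (m<n⇒m<1+n a<j))
                                   (All.map (<-trans a<j) j<js)) ⟩
  1 ∎
  where open ≡-Reasoning

onePositions-≥ : ∀ k xs → All (k ≤_) (onePositions (indexed k xs))
onePositions-≥ k []           = []
onePositions-≥ k (true ∷ xs)  = ≤-refl ∷ All.map (≤-trans (n≤1+n k)) (onePositions-≥ (suc k) xs)
onePositions-≥ k (false ∷ xs) = All.map (≤-trans (n≤1+n k)) (onePositions-≥ (suc k) xs)

onePositions-increasing : ∀ k xs → AllPairs _<_ (onePositions (indexed k xs))
onePositions-increasing k []           = []
onePositions-increasing k (true ∷ xs)  = onePositions-≥ (suc k) xs ∷ onePositions-increasing (suc k) xs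
onePositions-increasing k (false ∷ xs) = onePositions-increasing (suc k) xs

onePositions-∌false : ∀ {m} k (b : Vec Bool m) i → lookup b i ≡ false →
                      k + toℕ i ∉ onePositions (indexed k (Vec.toList b))
onePositions-∌false k (false Vec.∷ b) Fin.zero _ rewrite +-identityʳ k =
  <-irrefl refl ∘ All.lookup (onePositions-≥ (suc k) (Vec.toList b))
onePositions-∌false k (false Vec.∷ b) (Fin.suc i) bi≡false rewrite +-suc k (toℕ i) =
  onePositions-∌false (suc k) b i bi≡false
onePositions-∌false k (true Vec.∷ b) (Fin.suc i) bi≡false rewrite +-suc k (toℕ i) = λ where
  (here k+i≡k) → <-irrefl (sym k+i≡k) (s≤s (m≤m+n k (toℕ i)))
  (there ∈rest) → onePositions-∌false (suc k) b i bi≡false ∈rest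

zeroEdges-∋false : ∀ {m} k (b : Vec Bool m) i → lookup b i ≡ false →
                   (k + toℕ i + 1 , k + toℕ i + 2) ∈ zeroEdges (indexed k (Vec.toList b))
zeroEdges-∋false k (false Vec.∷ b) Fin.zero _ rewrite +-identityʳ k = here refl
zeroEdges-∋false k (false Vec.∷ b) (Fin.suc i) bi≡false rewrite +-suc k (toℕ i) =
  there (zeroEdges-∋false (suc k) b i bi≡false)
zeroEdges-∋false k (true Vec.∷ b) (Fin.suc i) bi≡false rewrite +-suc k (toℕ i) =
  zeroEdges-∋false (suc k) b i bi≡false

lemma3p18 : (n : ℕ) → 2 ≤ n → (b : Vec Bool (n ∸ 2)) → (i : Fin (n ∸ 2)) →
    lookup b i ≡ false →
    ((toℕ i + 2 , toℕ i + 3) ∈ nonSpineEdges n b)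
    × (countᵇ (nestsOver (toℕ i + 2) (toℕ i + 3)) (edgesG n b) ≡ 1)
lemma3p18 n@(suc (suc _)) _ b i bi≡false = cutEdge∈ , countCut
  where
  t : ℕ
  t = toℕ i
  bits : List Bool
  bits = Vec.toList b
  fixed zeros chain : List Edge
  fixed = (1 , 2) ∷ (n , n + 1) ∷ []
  zeros = zeroEdges (indexed 1 bits)
  chain = jumpChain n 1 (onePositions (indexed 1 bits))

  cutEdge∈ : (t + 2 , t + 3) ∈ nonSpineEdges n b
  cutEdge∈ = there (there (++⁺ˡ (subst (_∈ zeros) (cong₂ _,_ (sym (+-suc t 1)) (sym (+-suc t 2)))
                                      (zeroEdges-∋false 1 b i bi≡false))))

  nonChain-unit : All UnitEdge (spineEdges n ++ fixed ++ zeros)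
  nonChain-unit = ++⁺ (spineEdges-unit n) (refl ∷ +-comm n 1 ∷ zeroEdges-unit 1 bits)

  countCut : countᵇ (nestsOver (t + 2) (t + 3)) (edgesG n b) ≡ 1
  countCut rewrite +-comm t 2 | +-comm t 3 = begin
    countᵇ (nestsCut (suc t)) (spineEdges n ++ (fixed ++ zeros) ++ chain)
      ≡⟨ cong (countᵇ (nestsCut (suc t))) (sym (++-assoc (spineEdges n) (fixed ++ zeros) chain)) ⟩
    countᵇ (nestsCut (suc t)) ((spineEdges n ++ fixed ++ zeros) ++ chain)
      ≡⟨ countᵇ-++ (nestsCut (suc t)) (spineEdges n ++ fixed ++ zeros) chain ⟩
    countᵇ (nestsCut (suc t)) (spineEdges n ++ fixed ++ zeros) + countᵇ (nestsCut (suc t)) chain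
      ≡⟨ cong₂ _+_ (countᵇ-nestsOver-unitEdges {suc (suc t)} nonChain-unit)
                   (jumpChain-straddle n (s≤s z≤n) (s≤s (s≤s (toℕ<n i)))
                      (onePositions-increasing 1 bits) (onePositions-∌false 1 b i bi≡false)) ⟩
    1 ∎
    where open ≡-Reasoning
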